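{- Let $\mathbf{x}\in\mathcal{W}(\mathbb{Q})$ and $\mathbf{x}'=\mathbf{x}-\mathbf{n}_{r-1}\in\mathcal{A}(\mathbb{Q})$, where $\mathbf{n}_{r-1}=(1,\dots,1,0)$. Then for each $k\in\mathbb{N}$: $\mathbf{x}$ is $(k+1)$-inseparable if and only if $\mathbf{x}'$ is $k$-inseparable; i.e. $\mathbf{x}\in\mathcal{W}(k+1)\iff\mathbf{x}'\in\mathcal{A}(k)$.
   Context: $\mathbb{F}=\mathbb{F}_q$, $A=\mathbb{F}[T]$, $K_\infty=\mathbb{F}((T^{ -1}))$ with $|T|=q$, $r\ge2$, $V=K_\infty^r$ with standard basis $e_1,\dots,e_r$. The (rational points of the) standard apartment are $\mathcal{A}(\mathbb{Q})=\{\mathbf{x}\in\mathbb{Q}^r: x_r=0\}$ (identified with $\mathbb{Q}^r/\mathbb{Q}(1,\dots,1)$), and the standard Weyl chamber is $\mathcal{W}(\mathbb{Q})=\{\mathbf{x}\in\mathcal{A}(\mathbb{Q}): x_1\ge x_2\ge\dots\ge x_r\}$. For $\mathbf{x}\in\mathcal{A}(\mathbb{Q})$ let $\nu_{\mathbf{x}}$ be the norm on $V$ given by $\nu_{\mathbf{x}}(\sum v_ie_i)=\max_i |v_i|q^{x_i}$. For the $\mathbb{F}$-vector space $M=\bigoplus_i Ae_i$ with norm $\nu_{\mathbf{x}}$, an $\mathbb{F}$-successive minimum basis is an ordered $\mathbb{F}$-basis $(\mu_1,\mu_2,\dots)$ such that each $\mu_j$ has minimal norm in $M\setminus\sum_{l<j}\mathbb{F}\mu_l$;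 the norms $\nu_{\mathbf{x}}(\mu_1)\le\nu_{\mathbf{x}}(\mu_2)\le\cdots$ do not depend on the choice. $\mathbf{x}$ is called $k$-inseparable if $\nu_{\mathbf{x}}(\mu_k)=\nu_{\mathbf{x}}(\mu_{k+1})$. (Equivalently, the lattice $\Lambda_\omega=\sum A\omega_i$ is $k$-inseparable for any $\omega$ in the building-map fibre above $\mathbf{x}$.) $\mathcal{A}(k)$ denotes the set of $k$-inseparable points of $\mathcal{A}(\mathbb{Q})$ and $\mathcal{W}(k)=\mathcal{A}(k)\cap\mathcal{W}(\mathbb{Q})$. -}

module Defs where

open import Level using (Level; _⊔_)
open import Algebra.Bundles using (CommutativeRing)
open import Data.Nat as ℕ using (ℕ; zero; suc; _∸_)
open import Data.Fin as Fin using (Fin; toℕ; fromℕ)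
open import Data.List using (List; []; _∷_)
open import Data.Maybe using (Maybe; just; nothing)
open import Data.Product using (Σ; ∃; _×_; _,_)
open import Data.Unit using (⊤)
open import Data.Empty using (⊥)
open import Data.Integer using (+_)
open import Data.Rational as ℚ using (ℚ; 0ℚ; 1ℚ)
open import Relation.Nullary using (¬_; yes; no)
open import Relation.Binary using (Decidable)
open import Relation.Binary.PropositionalEquality using (_≡_)

record IsField {c ℓ : Level} (R : CommutativeRing c ℓ) : Set (c ⊔ ℓ) where
  open CommutativeRing R
  field
    1≉0     : ¬ (1# ≈ 0#)
    inverse : ∀ a → ¬ (a ≈ 0#) → ∃ λ b → (a * b) ≈ 1#

-- Points of the apartment, Weyl chamber, the vector n_{r-1}.
-- Points are vectors x : Fin r → ℚ (coordinates x_1..x_r are indices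
-- 0..r-1), normalised by x_r = 0.

InApartment : (r : ℕ) → (Fin r → ℚ) → Set
InApartment zero    x = ⊤
InApartment (suc m) x = x (fromℕ m) ≡ 0ℚ

InWeylChamber : (r : ℕ) → (Fin r → ℚ) → Set
InWeylChamber r x = ∀ (i j : Fin r) → i Fin.≤ j → x j ℚ.≤ x i

nVec : (m : ℕ) → Fin (suc m) → ℚ
nVec m i with toℕ i ℕ.<? m
... | yes _ = 1ℚ
... | no  _ = 0ℚ

shiftDown : (m : ℕ) → (Fin (suc m) → ℚ) → Fin (suc m) → ℚ
shiftDown m x i = x i ℚ.- nVec m i

-- Log-norms: values of log_q ν, with `nothing` standing for log_q 0 = -∞.
-- Since t ↦ q^t is strictly increasing, comparing/equating norms is the
-- same as comparing/equating their log_q.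

_⊔ₘ_ : Maybe ℚ → Maybe ℚ → Maybe ℚ
nothing ⊔ₘ b       = b
just a  ⊔ₘ nothing = just a
just a  ⊔ₘ just b  = just (a ℚ.⊔ b)

_≤ₘ_ : Maybe ℚ → Maybe ℚ → Set
nothing ≤ₘ _       = ⊤
just a  ≤ₘ nothing = ⊥
just a  ≤ₘ just b  = a ℚ.≤ b

maxOver : (r : ℕ) → (Fin r → Maybe ℚ) → Maybe ℚ
maxOver zero    f = nothing
maxOver (suc r) f = f Fin.zero ⊔ₘ maxOver r (λ i → f (Fin.suc i))

module PolyNorm {c ℓ : Level} (F : CommutativeRing c ℓ)
                (_≟_ : Decidable (CommutativeRing._≈_ F)) where
  open CommutativeRing F

  -- polynomials in A = F[T] as coefficient lists (constant term first);
  -- trailing zeros are allowed, polynomials are compared coefficientwise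
  Poly : Set c
  Poly = List Carrier

  coeff : Poly → ℕ → Carrier
  coeff []      n       = 0#
  coeff (a ∷ p) zero    = a
  coeff (a ∷ p) (suc n) = coeff p n

  deg : Poly → Maybe ℕ
  deg []      = nothing
  deg (a ∷ p) with deg p
  ... | just d  = just (suc d)
  ... | nothing with a ≟ 0#
  ...   | yes _ = nothing
  ...   | no  _ = just 0

  -- |f| = q^{deg f}, so log_q |f| = deg f
  logAbs : Poly → Maybe ℚ
  logAbs p with deg p
  ... | just d  = just ((+ d) ℚ./ 1)
  ... | nothing = nothing

  M : ℕ → Set c
  M r = Fin r → Poly

  logNorm : (r : ℕ) → (Fin r → ℚ) → M r → Maybe ℚ
  logNorm r x v = maxOver r (λ i → addTo (logAbs (v i)) (x i))
    where
    addTo : Maybe ℚ → ℚ → Maybe ℚ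
    addTo (just a) b = just (a ℚ.+ b)
    addTo nothing  b = nothing

  sumF : (j : ℕ) → (Fin j → Carrier) → Carrier
  sumF zero    f = 0#
  sumF (suc j) f = f Fin.zero + sumF j (λ l → f (Fin.suc l))

  -- w ∈ Σ_{l<j} F μ_l   (0-indexed: μ 0 is the paper's μ_1)
  InSpan : (r : ℕ) → (ℕ → M r) → ℕ → M r → Set (c ⊔ ℓ)
  InSpan r μ j w =
    Σ (Fin j → Carrier) λ a →
      ∀ (i : Fin r) (n : ℕ) →
        coeff (w i) n ≈ sumF j (λ l → a l * coeff (μ (toℕ l) i) n)

  -- (μ_1, μ_2, …) = (μ 0, μ 1, …) is an F-successive minimum basis of
  -- (M, ν_x): each μ_j lies in M ∖ Σ_{l<j} F μ_l and has minimal norm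
  -- there, and the μ_j span M (linear independence follows from the
  -- first condition).
  IsSuccMinBasis : (r : ℕ) → (Fin r → ℚ) → (ℕ → M r) → Set (c ⊔ ℓ)
  IsSuccMinBasis r x μ =
    (∀ j → ¬ InSpan r μ j (μ j)) ×
    (∀ j (w : M r) → ¬ InSpan r μ j w → logNorm r x (μ j) ≤ₘ logNorm r x w) ×
    (∀ (w : M r) → ∃ λ j → InSpan r μ j w)

  -- x is k-inseparable (k ≥ 1): ν_x(μ_k) = ν_x(μ_{k+1}) for an
  -- F-successive minimum basis (these norms do not depend on the choice).
  Inseparable : (r : ℕ) → (Fin r → ℚ) → ℕ → Set (c ⊔ ℓ)
  Inseparable r x k =
    Σ (ℕ → M r) λ μ →
      IsSuccMinBasis r x μ × (logNorm r x (μ (k ∸ 1)) ≡ logNorm r x (μ k))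

module Submission where

-- Multiplying the last coordinate by T, φ(v) = (v₁, …, v_{r-1}, T v_r), satisfies
-- ν_x(φ v) = q ν_{x′}(v), and its image is the F-hyperplane of vectors whose last
-- coordinate has zero constant term, complemented by e_r.  For x in the Weyl chamber
-- all x_i ≥ 0 = x_r, so ν_x(e_r) = 1 ≤ ν_x(w) for every w ≠ 0.  Hence if (μ′_j) is a
-- successive minimum basis for x′, then (e_r, φ μ′_1, φ μ′_2, …) is one for x.
-- Conversely, given (μ_j) for x, let μ_p be the first member whose last coordinate has
-- nonzero constant term; subtracting multiples of μ_p clears that term in all other
-- μ_t without changing their norms, and dividing by T then gives a basis for x′.
-- Since every member up to μ_p has the norm of e_r, in both cases the (j+1)-st
-- minimum for x is q times the j-th one for x′, which shifts the inseparability
-- index by one.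

open import Defs
open import Level using (Level; _⊔_; 0ℓ)
open import Algebra.Bundles using (CommutativeRing)
open import Data.Nat using (ℕ; zero; suc; _≤_; _<_; _<?_; z≤n; s≤s; s≤s⁻¹)
open import Data.Fin using (Fin; toℕ)
open import Data.Rational using (ℚ)
open import Function.Bundles using (Inverse; _⇔_; mk⇔; Equivalence)
open import Relation.Binary using (Decidable)
open import Relation.Binary.PropositionalEquality using (setoid)

import Data.Nat.Properties as ℕ
import Data.Nat.Coprimality as Coprime
import Data.Integer as ℤ
import Data.Integer.Properties as ℤ
import Data.Fin as Fin
import Data.Fin.Properties as Fin
import Data.Maybe as Maybe
import Data.Rational as ℚ
import Data.Rational.Properties as ℚ
import Data.Vec.Functional as Vector
import Relation.Binary.Reasoning.Setoid
import Relation.Binary.Reasoning.PartialOrder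
import Relation.Binary.PropositionalEquality as ≡
open import Relation.Binary.Bundles using (Poset)
open import Data.Empty using (⊥-elim)
open import Data.List as List using ([]; _∷_; drop)
open import Data.Maybe using (Maybe; just; nothing)
open import Data.Product using (∃; _×_; _,_; proj₁; proj₂)
open import Data.Sum using (_⊎_; inj₁; inj₂; [_,_]′)
open import Data.Unit using (tt)
open import Function using (_∘_)
open import Relation.Binary.Definitions using (tri<; tri≈; tri>)
open import Relation.Nullary using (¬_; Dec; yes; no)
open import Relation.Binary.PropositionalEquality
  using (_≡_; _≢_; refl; sym; trans; cong; cong₂; subst; subst₂; module ≡-Reasoning)

fromℕ : ℕ → ℚ
fromℕ d = ℤ.+ d ℚ./ 1

fromℕ≡mkℚ : ∀ d → fromℕ d ≡ ℚ.mkℚ (ℤ.+ d) 0 (Coprime.sym (Coprime.1-coprimeTo d))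
fromℕ≡mkℚ d = ℚ.normalize-coprime (Coprime.sym (Coprime.1-coprimeTo d))

fromℕ-suc : ∀ d → fromℕ (suc d) ≡ fromℕ d ℚ.+ ℚ.1ℚ
fromℕ-suc d rewrite fromℕ≡mkℚ d = cong (ℚ._/ 1) (trans (cong ℤ.+_ (ℕ.+-comm 1 d))
  (sym (cong₂ ℤ._+_ (ℤ.*-identityʳ (ℤ.+ d)) (ℤ.*-identityʳ (ℤ.+ 1)))))

fromℕ-mono-≤ : ∀ {d e} → d ≤ e → fromℕ d ℚ.≤ fromℕ e
fromℕ-mono-≤ {d} {e} d≤e rewrite fromℕ≡mkℚ d | fromℕ≡mkℚ e =
  ℚ.*≤* (subst₂ ℤ._≤_ (sym (ℤ.*-identityʳ (ℤ.+ d))) (sym (ℤ.*-identityʳ (ℤ.+ e))) (ℤ.+≤+ d≤e))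

fromℕ-nonNeg : ∀ d → ℚ.0ℚ ℚ.≤ fromℕ d
fromℕ-nonNeg d = ℚ.nonNegative⁻¹ (fromℕ d) {{ℚ.normalize-nonNeg d 1}}

p-q+q≡p : ∀ p q → (p ℚ.- q) ℚ.+ q ≡ p
p-q+q≡p p q = trans (ℚ.+-assoc p (ℚ.- q) q) (trans (cong (p ℚ.+_) (ℚ.+-inverseˡ q)) (ℚ.+-identityʳ p))

-- Extended log-norm values

≤ₘ-refl : ∀ a → a ≤ₘ a
≤ₘ-refl nothing  = tt
≤ₘ-refl (just a) = ℚ.≤-refl

≤ₘ-reflexive : ∀ {a b} → a ≡ b → a ≤ₘ b
≤ₘ-reflexive {a} refl = ≤ₘ-refl a

≤ₘ-trans : ∀ {a b c} → a ≤ₘ b → b ≤ₘ c → a ≤ₘ c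
≤ₘ-trans {nothing}                     _ _ = tt
≤ₘ-trans {just a} {just b} {just c} p q = ℚ.≤-trans p q

≤ₘ-antisym : ∀ {a b} → a ≤ₘ b → b ≤ₘ a → a ≡ b
≤ₘ-antisym {nothing} {nothing} _ _ = refl
≤ₘ-antisym {just a}  {just b}  p q = cong just (ℚ.≤-antisym p q)

≤ₘ-poset : Poset 0ℓ 0ℓ 0ℓ
≤ₘ-poset = record
  { _≤_            = _≤ₘ_
  ; isPartialOrder = record
    { isPreorder = record { isEquivalence = ≡.isEquivalence ; reflexive = ≤ₘ-reflexive ; trans = ≤ₘ-trans }
    ; antisym    = ≤ₘ-antisym
    }
  }

module ≤ₘ-Reasoning = Relation.Binary.Reasoning.PartialOrder ≤ₘ-poset

a≤ₘa⊔ₘb : ∀ a b → a ≤ₘ (a ⊔ₘ b)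
a≤ₘa⊔ₘb nothing  b        = tt
a≤ₘa⊔ₘb (just a) nothing  = ℚ.≤-refl
a≤ₘa⊔ₘb (just a) (just b) = ℚ.p≤p⊔q a b

b≤ₘa⊔ₘb : ∀ a b → b ≤ₘ (a ⊔ₘ b)
b≤ₘa⊔ₘb nothing  b        = ≤ₘ-refl b
b≤ₘa⊔ₘb (just a) nothing  = tt
b≤ₘa⊔ₘb (just a) (just b) = ℚ.p≤q⊔p a b

⊔ₘ-lub : ∀ {a b c} → a ≤ₘ c → b ≤ₘ c → (a ⊔ₘ b) ≤ₘ c
⊔ₘ-lub {nothing}                     _ q = q
⊔ₘ-lub {just a} {nothing}            p _ = p
⊔ₘ-lub {just a} {just b} {just c}    p q = ℚ.⊔-lub p q

⊔ₘ-mono-≤ₘ : ∀ {a b c d} → a ≤ₘ c → b ≤ₘ d → (a ⊔ₘ b) ≤ₘ (c ⊔ₘ d)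
⊔ₘ-mono-≤ₘ {c = c} {d} p q = ⊔ₘ-lub (≤ₘ-trans p (a≤ₘa⊔ₘb c d)) (≤ₘ-trans q (b≤ₘa⊔ₘb c d))

infixl 6 _+ₘ_

_+ₘ_ : Maybe ℚ → ℚ → Maybe ℚ
a +ₘ c = Maybe.map (ℚ._+ c) a

+ₘ-mono-≤ₘ : ∀ {a b} c → a ≤ₘ b → (a +ₘ c) ≤ₘ (b +ₘ c)
+ₘ-mono-≤ₘ {nothing}          c _ = tt
+ₘ-mono-≤ₘ {just a} {just b} c p = ℚ.+-monoˡ-≤ c p

+ₘ-assoc : ∀ a b c → (a +ₘ b) +ₘ c ≡ a +ₘ (b ℚ.+ c)
+ₘ-assoc nothing  b c = refl
+ₘ-assoc (just a) b c = cong just (ℚ.+-assoc a b c)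

+ₘ-identityʳ : ∀ a → a +ₘ ℚ.0ℚ ≡ a
+ₘ-identityʳ nothing  = refl
+ₘ-identityʳ (just a) = cong just (ℚ.+-identityʳ a)

+ₘ-cancelʳ : ∀ a c → (a +ₘ c) +ₘ ℚ.- c ≡ a
+ₘ-cancelʳ a c = trans (+ₘ-assoc a c (ℚ.- c)) (trans (cong (a +ₘ_) (ℚ.+-inverseʳ c)) (+ₘ-identityʳ a))

+ₘ-cancelʳ-≤ₘ : ∀ {a b} c → (a +ₘ c) ≤ₘ (b +ₘ c) → a ≤ₘ b
+ₘ-cancelʳ-≤ₘ {a} {b} c p =
  subst₂ _≤ₘ_ (+ₘ-cancelʳ a c) (+ₘ-cancelʳ b c) (+ₘ-mono-≤ₘ (ℚ.- c) p)

+ₘ-cancelʳ-≡ : ∀ {a b} c → a +ₘ c ≡ b +ₘ c → a ≡ b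
+ₘ-cancelʳ-≡ {a} {b} c p = subst₂ _≡_ (+ₘ-cancelʳ a c) (+ₘ-cancelʳ b c) (cong (_+ₘ ℚ.- c) p)

+ₘ-distrib-⊔ₘ : ∀ a b c → (a ⊔ₘ b) +ₘ c ≡ (a +ₘ c) ⊔ₘ (b +ₘ c)
+ₘ-distrib-⊔ₘ nothing  b        c = refl
+ₘ-distrib-⊔ₘ (just a) nothing  c = refl
+ₘ-distrib-⊔ₘ (just a) (just b) c =
  cong just (ℚ.mono-≤-distrib-⊔ {f = ℚ._+ c} (ℚ.+-monoˡ-≤ c) a b)

shifted-≡⇔ : ∀ (a b : ℕ → Maybe ℚ) c → (∀ j → a (suc j) ≡ b j +ₘ c) →
             ∀ k → (a (suc k) ≡ a (suc (suc k))) ⇔ (b k ≡ b (suc k))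
shifted-≡⇔ a b c a≡b+c k = mk⇔
  (λ p → +ₘ-cancelʳ-≡ c (trans (sym (a≡b+c k)) (trans p (a≡b+c (suc k)))))
  (λ p → trans (a≡b+c k) (trans (cong (_+ₘ c) p) (sym (a≡b+c (suc k)))))

maxOver-cong : ∀ r {f g : Fin r → Maybe ℚ} → (∀ i → f i ≡ g i) → maxOver r f ≡ maxOver r g
maxOver-cong zero    f≡g = refl
maxOver-cong (suc r) f≡g = cong₂ _⊔ₘ_ (f≡g Fin.zero) (maxOver-cong r (f≡g ∘ Fin.suc))

≤ₘ-maxOver : ∀ r (f : Fin r → Maybe ℚ) i → f i ≤ₘ maxOver r f
≤ₘ-maxOver (suc r) f Fin.zero    = a≤ₘa⊔ₘb (f Fin.zero) _
≤ₘ-maxOver (suc r) f (Fin.suc i) = ≤ₘ-trans (≤ₘ-maxOver r (f ∘ Fin.suc) i) (b≤ₘa⊔ₘb (f Fin.zero) _)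

maxOver-lub : ∀ r (f : Fin r → Maybe ℚ) {b} → (∀ i → f i ≤ₘ b) → maxOver r f ≤ₘ b
maxOver-lub zero    f f≤b = tt
maxOver-lub (suc r) f f≤b = ⊔ₘ-lub (f≤b Fin.zero) (maxOver-lub r (f ∘ Fin.suc) (f≤b ∘ Fin.suc))

maxOver-+ₘ : ∀ r (f : Fin r → Maybe ℚ) c → maxOver r (λ i → f i +ₘ c) ≡ maxOver r f +ₘ c
maxOver-+ₘ zero    f c = refl
maxOver-+ₘ (suc r) f c =
  trans (cong ((f Fin.zero +ₘ c) ⊔ₘ_) (maxOver-+ₘ r (f ∘ Fin.suc) c))
        (sym (+ₘ-distrib-⊔ₘ (f Fin.zero) _ c))

infix 10 _↾_

_↾_ : ∀ {a} {A : Set a} → (ℕ → A) → (j : ℕ) → Fin j → A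
(μ ↾ j) l = μ (toℕ l)

skip : ℕ → ℕ → ℕ
skip p j with j <? p
... | yes _ = j
... | no  _ = suc j

skip-< : ∀ {p j} → j < p → skip p j ≡ j
skip-< {p} {j} j<p with j <? p
... | yes _   = refl
... | no  j≮p = ⊥-elim (j≮p j<p)

skip-≥ : ∀ {p j} → p ≤ j → skip p j ≡ suc j
skip-≥ {p} {j} p≤j with j <? p
... | yes j<p = ⊥-elim (ℕ.<⇒≱ j<p p≤j)
... | no  _   = refl

skip-≢ : ∀ p j → skip p j < p ⊎ p < skip p j
skip-≢ p j with j <? p
... | yes j<p = inj₁ j<p
... | no  j≮p = inj₂ (s≤s (ℕ.≮⇒≥ j≮p))

n≤skip : ∀ p j → j ≤ skip p j
n≤skip p j with j <? p
... | yes _ = ℕ.≤-refl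
... | no  _ = ℕ.n≤1+n j

skip-mono-< : ∀ p {l j} → l < j → skip p l < skip p j
skip-mono-< p {l} {j} l<j with l <? p | j <? p
... | yes _   | yes _   = l<j
... | yes _   | no  _   = ℕ.m<n⇒m<1+n l<j
... | no  l≮p | yes j<p = ⊥-elim (l≮p (ℕ.<-trans l<j j<p))
... | no  _   | no  _   = s≤s l<j

skip-cancel-< : ∀ p {l j} → skip p l < skip p j → l < j
skip-cancel-< p {l} {j} lt with ℕ.<-cmp l j
... | tri< l<j _ _ = l<j
... | tri≈ _ refl _ = ⊥-elim (ℕ.<-irrefl refl lt)
... | tri> _ _ j<l = ⊥-elim (ℕ.<-asym lt (skip-mono-< p j<l))

skip-surjective : ∀ {p t} → t ≢ p → ∃ λ j → skip p j ≡ t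
skip-surjective {p} {t} t≢p with t <? p
skip-surjective {p} {t}     t≢p | yes t<p = t , skip-< t<p
skip-surjective {p} {zero}  t≢p | no  t≮p = ⊥-elim (t≢p (sym (ℕ.n≤0⇒n≡0 (ℕ.≮⇒≥ t≮p))))
skip-surjective {p} {suc t} t≢p | no  t≮p =
  t , skip-≥ (s≤s⁻¹ (ℕ.≤∧≢⇒< (ℕ.≮⇒≥ t≮p) (t≢p ∘ sym)))

-- Polynomials, norms and spans

module _ {c ℓ : Level} (F : CommutativeRing c ℓ)
         (_≟_ : Decidable (CommutativeRing._≈_ F)) where

  open CommutativeRing F
    renaming (Carrier to K; refl to ≈-refl; sym to ≈-sym; trans to ≈-trans; setoid to ≈-setoid)
  open PolyNorm F _≟_
  open import Algebra.Properties.Semiring.Sum semiring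
    using ( sum; sum-syntax; sum-cong-≋; sum-replicate-zero; ∑-distrib-+; ∑-comm
          ; *-distribˡ-sum; *-distribʳ-sum)
  open import Algebra.Properties.Ring ring using (-‿distribˡ-*; -0#≈0#)
  module ≈-Reasoning = Relation.Binary.Reasoning.Setoid ≈-setoid

  deg≡nothing⇒coeff≈0 : ∀ p → deg p ≡ nothing → ∀ n → coeff p n ≈ 0#
  deg≡nothing⇒coeff≈0 []      _ n = ≈-refl
  deg≡nothing⇒coeff≈0 (a ∷ p) e n with deg p in deg-p
  deg≡nothing⇒coeff≈0 (a ∷ p) () n       | just _
  ... | nothing with a ≟ 0#
  deg≡nothing⇒coeff≈0 (a ∷ p) e zero    | nothing | yes a≈0 = a≈0
  deg≡nothing⇒coeff≈0 (a ∷ p) e (suc n) | nothing | yes _   = deg≡nothing⇒coeff≈0 p deg-p n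
  deg≡nothing⇒coeff≈0 (a ∷ p) () n      | nothing | no  _

  deg≡just⇒coeff≉0 : ∀ p {d} → deg p ≡ just d → ¬ coeff p d ≈ 0#
  deg≡just⇒coeff≉0 (a ∷ p) e with deg p in deg-p
  deg≡just⇒coeff≉0 (a ∷ p) refl | just _ = deg≡just⇒coeff≉0 p deg-p
  ... | nothing with a ≟ 0#
  deg≡just⇒coeff≉0 (a ∷ p) ()   | nothing | yes _
  deg≡just⇒coeff≉0 (a ∷ p) refl | nothing | no a≉0 = a≉0

  coeff≉0⇒≤deg : ∀ p n → ¬ coeff p n ≈ 0# → ∃ λ d → deg p ≡ just d × n ≤ d
  coeff≉0⇒≤deg [] n coeff≉0 = ⊥-elim (coeff≉0 ≈-refl)
  coeff≉0⇒≤deg (a ∷ p) n coeff≉0 with deg p in deg-p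
  coeff≉0⇒≤deg (a ∷ p) zero    coeff≉0 | just d = suc d , refl , z≤n
  coeff≉0⇒≤deg (a ∷ p) (suc n) coeff≉0 | just d with coeff≉0⇒≤deg p n coeff≉0
  ... | d′ , deg-p′ , n≤d′ with trans (sym deg-p) deg-p′
  ...   | refl = suc d , refl , s≤s n≤d′
  coeff≉0⇒≤deg (a ∷ p) zero    coeff≉0 | nothing with a ≟ 0#
  ... | yes a≈0 = ⊥-elim (coeff≉0 a≈0)
  ... | no  _   = 0 , refl , z≤n
  coeff≉0⇒≤deg (a ∷ p) (suc n) coeff≉0 | nothing =
    ⊥-elim (coeff≉0 (deg≡nothing⇒coeff≈0 p deg-p n))

  deg-0∷ : ∀ p → deg (0# ∷ p) ≡ Maybe.map suc (deg p)
  deg-0∷ p with deg p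
  ... | just _  = refl
  ... | nothing with 0# ≟ 0#
  ...   | yes _   = refl
  ...   | no 0≉0 = ⊥-elim (0≉0 ≈-refl)

  logAbs-0∷ : ∀ p → logAbs (0# ∷ p) ≡ logAbs p +ₘ ℚ.1ℚ
  logAbs-0∷ p rewrite deg-0∷ p with deg p
  ... | just d  = cong just (fromℕ-suc d)
  ... | nothing = refl

  logAbs-[a] : ∀ {a} → ¬ a ≈ 0# → logAbs (a ∷ []) ≡ just ℚ.0ℚ
  logAbs-[a] {a} a≉0 with a ≟ 0#
  ... | yes a≈0 = ⊥-elim (a≉0 a≈0)
  ... | no  _   = refl

  fromℕ≤logAbs : ∀ p n → ¬ coeff p n ≈ 0# → just (fromℕ n) ≤ₘ logAbs p
  fromℕ≤logAbs p n coeff≉0 with coeff≉0⇒≤deg p n coeff≉0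
  ... | d , deg-p , n≤d rewrite deg-p = fromℕ-mono-≤ n≤d

  logAbs-supported : ∀ R P Q → (∀ n → coeff P n ≈ 0# → coeff Q n ≈ 0# → coeff R n ≈ 0#) →
                     logAbs R ≤ₘ (logAbs P ⊔ₘ logAbs Q)
  logAbs-supported R P Q supp with deg R in deg-R
  ... | nothing = tt
  ... | just d with coeff P d ≟ 0# | coeff Q d ≟ 0#
  ...   | no  P≉0 | _       = ≤ₘ-trans (fromℕ≤logAbs P d P≉0) (a≤ₘa⊔ₘb _ _)
  ...   | yes _   | no  Q≉0 = ≤ₘ-trans (fromℕ≤logAbs Q d Q≉0) (b≤ₘa⊔ₘb _ _)
  ...   | yes P≈0 | yes Q≈0 = ⊥-elim (deg≡just⇒coeff≉0 R deg-R (supp d P≈0 Q≈0))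

  infixl 6 _+ᴾ_
  infixr 7 _·ᴾ_

  _+ᴾ_ : Poly → Poly → Poly
  []      +ᴾ q       = q
  (a ∷ p) +ᴾ []      = a ∷ p
  (a ∷ p) +ᴾ (b ∷ q) = (a + b) ∷ (p +ᴾ q)

  _·ᴾ_ : K → Poly → Poly
  a ·ᴾ p = List.map (a *_) p

  coeff-+ᴾ : ∀ p q n → coeff (p +ᴾ q) n ≈ coeff p n + coeff q n
  coeff-+ᴾ []      q       n       = ≈-sym (+-identityˡ _)
  coeff-+ᴾ (a ∷ p) []      n       = ≈-sym (+-identityʳ _)
  coeff-+ᴾ (a ∷ p) (b ∷ q) zero    = ≈-refl
  coeff-+ᴾ (a ∷ p) (b ∷ q) (suc n) = coeff-+ᴾ p q n

  coeff-·ᴾ : ∀ a p n → coeff (a ·ᴾ p) n ≈ a * coeff p n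
  coeff-·ᴾ a []      n       = ≈-sym (zeroʳ a)
  coeff-·ᴾ a (b ∷ p) zero    = ≈-refl
  coeff-·ᴾ a (b ∷ p) (suc n) = coeff-·ᴾ a p n

  infix 4 _≋_

  _≋_ : ∀ {r} → M r → M r → Set ℓ
  u ≋ v = ∀ i n → coeff (u i) n ≈ coeff (v i) n

  IsZero : ∀ {r} → M r → Set ℓ
  IsZero v = ∀ i n → coeff (v i) n ≈ 0#

  norm : (r : ℕ) → (Fin r → ℚ) → M r → Maybe ℚ
  norm r y v = maxOver r (λ i → logAbs (v i) +ₘ y i)

  -- Defs builds the terms of `logNorm` with a helper local to its definition, which
  -- cannot be referred to; `logNormTerm` is solved by unification against
  -- `logNorm-unfold`, and so names those terms.
  mutual
    logNormTerm : (r : ℕ) → (Fin r → ℚ) → M r → Fin r → Maybe ℚ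
    logNormTerm r y v = _

    logNorm-unfold : ∀ r y v → logNorm r y v ≡ maxOver r (logNormTerm r y v)
    logNorm-unfold r y v = refl

  logNorm≡norm : ∀ r y v → logNorm r y v ≡ norm r y v
  logNorm≡norm r y v = trans (logNorm-unfold r y v) (maxOver-cong r term≡)
    where
    term≡ : ∀ i → logNormTerm r y v i ≡ logAbs (v i) +ₘ y i
    term≡ i with logAbs (v i)
    ... | just _  = refl
    ... | nothing = refl

  norm-supported : ∀ {r} y (w u v : M r) →
                   (∀ i n → coeff (u i) n ≈ 0# → coeff (v i) n ≈ 0# → coeff (w i) n ≈ 0#) →
                   norm r y w ≤ₘ (norm r y u ⊔ₘ norm r y v)
  norm-supported {r} y w u v supp = maxOver-lub r _ term≤
    where
    term≤ : ∀ i → (logAbs (w i) +ₘ y i) ≤ₘ (norm r y u ⊔ₘ norm r y v)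
    term≤ i = ≤ₘ-trans (+ₘ-mono-≤ₘ (y i) (logAbs-supported (w i) (u i) (v i) (supp i)))
      (≤ₘ-trans (≤ₘ-reflexive (+ₘ-distrib-⊔ₘ (logAbs (u i)) (logAbs (v i)) (y i)))
        (⊔ₘ-mono-≤ₘ (≤ₘ-maxOver r (λ i → logAbs (u i) +ₘ y i) i)
                    (≤ₘ-maxOver r (λ i → logAbs (v i) +ₘ y i) i)))

  norm-mono : ∀ {r} y (w u : M r) → (∀ i n → coeff (u i) n ≈ 0# → coeff (w i) n ≈ 0#) →
              norm r y w ≤ₘ norm r y u
  norm-mono {r} y w u supp = ≤ₘ-trans (norm-supported y w u u (λ i n u≈0 _ → supp i n u≈0))
                                      (⊔ₘ-lub (≤ₘ-refl (norm r y u)) (≤ₘ-refl (norm r y u)))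

  norm-cong : ∀ {r} y {w w′ : M r} → w ≋ w′ → norm r y w ≡ norm r y w′
  norm-cong y {w} {w′} w≋w′ = ≤ₘ-antisym (norm-mono y w w′ (λ i n z → ≈-trans (w≋w′ i n) z))
                                         (norm-mono y w′ w (λ i n z → ≈-trans (≈-sym (w≋w′ i n)) z))

  norm-nonNeg : ∀ {r} y (w : M r) → (∀ i → ℚ.0ℚ ℚ.≤ y i) → ¬ IsZero w → just ℚ.0ℚ ≤ₘ norm r y w
  norm-nonNeg {zero}  y w y≥0 w≉0 = ⊥-elim (w≉0 λ ())
  norm-nonNeg {suc r} y w y≥0 w≉0 with deg (w Fin.zero) in deg-w₀
  ... | just d =
    ≤ₘ-trans term≥0 (a≤ₘa⊔ₘb (just (fromℕ d ℚ.+ y Fin.zero)) (norm r (y ∘ Fin.suc) (w ∘ Fin.suc)))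
    where
    term≥0 : ℚ.0ℚ ℚ.≤ fromℕ d ℚ.+ y Fin.zero
    term≥0 = ℚ.≤-trans (ℚ.≤-reflexive (sym (ℚ.+-identityʳ ℚ.0ℚ)))
                       (ℚ.+-mono-≤ (fromℕ-nonNeg d) (y≥0 Fin.zero))
  ... | nothing =
    ≤ₘ-trans (norm-nonNeg (y ∘ Fin.suc) (w ∘ Fin.suc) (y≥0 ∘ Fin.suc) tail≉0) (b≤ₘa⊔ₘb _ _)
    where
    tail≉0 : ¬ IsZero (w ∘ Fin.suc)
    tail≉0 tail≈0 = w≉0 λ where
      Fin.zero    n → deg≡nothing⇒coeff≈0 (w Fin.zero) deg-w₀ n
      (Fin.suc i) n → tail≈0 i n

  sumF≡sum : ∀ j (f : Fin j → K) → sumF j f ≡ sum f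
  sumF≡sum zero    f = refl
  sumF≡sum (suc j) f = cong (f Fin.zero +_) (sumF≡sum j (f ∘ Fin.suc))

  ∑≈0 : ∀ {j} {f : Fin j → K} → (∀ l → f l ≈ 0#) → ∑[ l < j ] f l ≈ 0#
  ∑≈0 {j} f≈0 = ≈-trans (sum-cong-≋ f≈0) (sum-replicate-zero j)

  δ : ∀ {j} → Fin j → Fin j → K
  δ Fin.zero    Fin.zero    = 1#
  δ Fin.zero    (Fin.suc _) = 0#
  δ (Fin.suc _) Fin.zero    = 0#
  δ (Fin.suc k) (Fin.suc l) = δ k l

  ∑-δ : ∀ {j} (k : Fin j) (f : Fin j → K) → ∑[ l < j ] (δ k l * f l) ≈ f k
  ∑-δ Fin.zero    f =
    ≈-trans (+-cong (*-identityˡ _) (∑≈0 {f = λ l → 0# * f (Fin.suc l)} λ l → zeroˡ _)) (+-identityʳ _)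
  ∑-δ (Fin.suc k) f = ≈-trans (+-cong (zeroˡ _) (∑-δ k (f ∘ Fin.suc))) (+-identityˡ _)

  record Span {r} (j : ℕ) (g : Fin j → M r) (w : M r) : Set (c ⊔ ℓ) where
    constructor span
    field
      coefficient : Fin j → K
      expansion   : ∀ i n → coeff (w i) n ≈ ∑[ l < j ] (coefficient l * coeff (g l i) n)

  Span-∋ : ∀ {r j} (g : Fin j → M r) k → Span j g (g k)
  Span-∋ g k = span (δ k) λ i n → ≈-sym (∑-δ k (λ l → coeff (g l i) n))

  Span-resp-≋ : ∀ {r j} {g : Fin j → M r} {w w′} → w ≋ w′ → Span j g w′ → Span j g w
  Span-resp-≋ w≋w′ (span a w′≈) = span a λ i n → ≈-trans (w≋w′ i n) (w′≈ i n)

  IsZero⇒Span : ∀ {r j} {g : Fin j → M r} {w} → IsZero w → Span j g w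
  IsZero⇒Span {g = g} w≈0 = span (λ _ → 0#) λ i n →
    ≈-trans (w≈0 i n) (≈-sym (∑≈0 {f = λ l → 0# * coeff (g l i) n} λ l → zeroˡ _))

  Span-coeff≈0 : ∀ {r j} {g : Fin j → M r} {w} i n →
                 (∀ l → coeff (g l i) n ≈ 0#) → Span j g w → coeff (w i) n ≈ 0#
  Span-coeff≈0 i n g≈0 (span a w≈) = ≈-trans (w≈ i n) (∑≈0 λ l → ≈-trans (*-congˡ (g≈0 l)) (zeroʳ _))

  Span-trans : ∀ {r j k} {g : Fin j → M r} {h : Fin k → M r} {w} →
               (∀ l → Span k h (g l)) → Span j g w → Span k h w
  Span-trans {j = j} {k} {g} {h} {w} g∈ (span a w≈) = span (λ t → ∑[ l < j ] (a l * b l t)) λ i n → begin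
    coeff (w i) n
      ≈⟨ w≈ i n ⟩
    ∑[ l < j ] (a l * coeff (g l i) n)
      ≈⟨ sum-cong-≋ (λ l → *-congˡ (Span.expansion (g∈ l) i n)) ⟩
    ∑[ l < j ] (a l * ∑[ t < k ] (b l t * coeff (h t i) n))
      ≈⟨ sum-cong-≋ (λ l → *-distribˡ-sum (a l) (λ t → b l t * coeff (h t i) n)) ⟩
    ∑[ l < j ] ∑[ t < k ] (a l * (b l t * coeff (h t i) n))
      ≈⟨ ∑-comm (λ l t → a l * (b l t * coeff (h t i) n)) ⟩
    ∑[ t < k ] ∑[ l < j ] (a l * (b l t * coeff (h t i) n))
      ≈⟨ sum-cong-≋ (λ t → sum-cong-≋ λ l → ≈-sym (*-assoc (a l) (b l t) (coeff (h t i) n))) ⟩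
    ∑[ t < k ] ∑[ l < j ] (a l * b l t * coeff (h t i) n)
      ≈⟨ sum-cong-≋ (λ t → ≈-sym (*-distribʳ-sum (coeff (h t i) n) (λ l → a l * b l t))) ⟩
    ∑[ t < k ] (∑[ l < j ] (a l * b l t) * coeff (h t i) n)
      ∎
    where
    open ≈-Reasoning
    b : Fin j → Fin k → K
    b l = Span.coefficient (g∈ l)

  Span-+· : ∀ {r j} {g : Fin j → M r} {u v w} β → Span j g u → Span j g v →
            (∀ i n → coeff (w i) n ≈ coeff (u i) n + β * coeff (v i) n) → Span j g w
  Span-+· {j = j} {g} {u} {v} {w} β (span a u≈) (span b v≈) w≈ = span (λ l → a l + β * b l) λ i n → begin
    coeff (w i) n
      ≈⟨ w≈ i n ⟩
    coeff (u i) n + β * coeff (v i) n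
      ≈⟨ +-cong (u≈ i n) (*-congˡ (v≈ i n)) ⟩
    ∑[ l < j ] (a l * coeff (g l i) n) + β * ∑[ l < j ] (b l * coeff (g l i) n)
      ≈⟨ +-congˡ (*-distribˡ-sum β (λ l → b l * coeff (g l i) n)) ⟩
    ∑[ l < j ] (a l * coeff (g l i) n) + ∑[ l < j ] (β * (b l * coeff (g l i) n))
      ≈⟨ ∑-distrib-+ (λ l → a l * coeff (g l i) n) (λ l → β * (b l * coeff (g l i) n)) ⟨
    ∑[ l < j ] (a l * coeff (g l i) n + β * (b l * coeff (g l i) n))
      ≈⟨ sum-cong-≋ (λ l → ≈-trans (+-congˡ (≈-sym (*-assoc β (b l) (coeff (g l i) n))))
                                  (≈-sym (distribʳ (coeff (g l i) n) (a l) (β * b l)))) ⟩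
    ∑[ l < j ] ((a l + β * b l) * coeff (g l i) n)
      ∎
    where open ≈-Reasoning

  Span-↾-∋ : ∀ {r t j} (ν : ℕ → M r) → t < j → Span j (ν ↾ j) (ν t)
  Span-↾-∋ {t = t} {j} ν t<j =
    subst (Span j (ν ↾ j)) (cong ν (Fin.toℕ-fromℕ< t<j)) (Span-∋ (ν ↾ j) (Fin.fromℕ< t<j))

  Span-∷ : ∀ {r j} {g : Fin j → M r} {w} h → Span j g w → Span (suc j) (h Vector.∷ g) w
  Span-∷ {g = g} h = Span-trans (λ l → Span-∋ (h Vector.∷ g) (Fin.suc l))

  Span-≗ : ∀ {r j} {g h : Fin j → M r} {w} → (∀ l → g l ≡ h l) → Span j g w → Span j h w
  Span-≗ {g = g} {h} g≗h = Span-trans (λ l → subst (Span _ h) (sym (g≗h l)) (Span-∋ h l))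

  InSpan⇒Span : ∀ {r} μ j (w : M r) → InSpan r μ j w → Span j (μ ↾ j) w
  InSpan⇒Span μ j w (a , w≈) = span a λ i n → ≈-trans (w≈ i n) (reflexive (sumF≡sum j _))

  Span⇒InSpan : ∀ {r} μ j (w : M r) → Span j (μ ↾ j) w → InSpan r μ j w
  Span⇒InSpan μ j w (span a w≈) = a , λ i n → ≈-trans (w≈ i n) (reflexive (sym (sumF≡sum j _)))

  record SuccMinBasis (r : ℕ) (y : Fin r → ℚ) (μ : ℕ → M r) : Set (c ⊔ ℓ) where
    field
      independent : ∀ j → ¬ Span j (μ ↾ j) (μ j)
      minimal     : ∀ j w → ¬ Span j (μ ↾ j) w → norm r y (μ j) ≤ₘ norm r y w
      spanning    : ∀ w → ∃ λ j → Span j (μ ↾ j) w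

    prefix-mono : ∀ {j k w} → j ≤ k → Span j (μ ↾ j) w → Span k (μ ↾ k) w
    prefix-mono j≤k = Span-trans (λ l → Span-↾-∋ μ (ℕ.<-≤-trans (Fin.toℕ<n l) j≤k))

    norm-mono-≤ : ∀ {t t′} → t ≤ t′ → norm r y (μ t) ≤ₘ norm r y (μ t′)
    norm-mono-≤ {t} {t′} t≤t′ = minimal t (μ t′) (independent t′ ∘ prefix-mono t≤t′)

    nonZero : ∀ t → ¬ IsZero (μ t)
    nonZero t μ≈0 = independent t (IsZero⇒Span μ≈0)

  fromIsSuccMinBasis : ∀ {r y μ} → IsSuccMinBasis r y μ → SuccMinBasis r y μ
  fromIsSuccMinBasis {r} {y} {μ} (independent , minimal , spanning) = record
    { independent = λ j → independent j ∘ Span⇒InSpan μ j (μ j)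
    ; minimal     = λ j w w∉ → subst₂ _≤ₘ_ (logNorm≡norm r y (μ j)) (logNorm≡norm r y w)
                                       (minimal j w (w∉ ∘ InSpan⇒Span μ j w))
    ; spanning    = λ w → let j , w∈ = spanning w in j , InSpan⇒Span μ j w w∈
    }

  toIsSuccMinBasis : ∀ {r y μ} → SuccMinBasis r y μ → IsSuccMinBasis r y μ
  toIsSuccMinBasis {r} {y} {μ} B =
      (λ j → independent j ∘ InSpan⇒Span μ j (μ j))
    , (λ j w w∉ → subst₂ _≤ₘ_ (sym (logNorm≡norm r y (μ j))) (sym (logNorm≡norm r y w))
                             (minimal j w (w∉ ∘ Span⇒InSpan μ j w)))
    , (λ w → let j , w∈ = spanning w in j , Span⇒InSpan μ j w w∈)
    where open SuccMinBasis B

  -- Multiplying the last coordinate by T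

  module LastCoordinate (m : ℕ) where

    last : Fin (suc m)
    last = Fin.fromℕ m

    last≮m : ¬ toℕ last < m
    last≮m = ℕ.<-irrefl (Fin.toℕ-fromℕ m)

    ≮m⇒last : ∀ i → ¬ toℕ i < m → i ≡ last
    ≮m⇒last i i≮m = Fin.toℕ-injective
      (trans (ℕ.≤-antisym (s≤s⁻¹ (Fin.toℕ<n i)) (ℕ.≮⇒≥ i≮m)) (sym (Fin.toℕ-fromℕ m)))

    shiftIndex : Fin (suc m) → ℕ → ℕ
    shiftIndex i n with toℕ i <? m
    ... | yes _ = n
    ... | no  _ = suc n

    shiftLast : M (suc m) → M (suc m)
    shiftLast v i with toℕ i <? m
    ... | yes _ = v i
    ... | no  _ = 0# ∷ v i

    unshiftLast : M (suc m) → M (suc m)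
    unshiftLast w i with toℕ i <? m
    ... | yes _ = w i
    ... | no  _ = drop 1 (w i)

    eLast : M (suc m)
    eLast i with toℕ i <? m
    ... | yes _ = []
    ... | no  _ = 1# ∷ []

    constLast : M (suc m) → K
    constLast w = coeff (w last) 0

    shiftIndex-< : ∀ {i} n → toℕ i < m → shiftIndex i n ≡ n
    shiftIndex-< {i} n i<m with toℕ i <? m
    ... | yes _   = refl
    ... | no  i≮m = ⊥-elim (i≮m i<m)

    shiftIndex-≮ : ∀ {i} n → ¬ toℕ i < m → shiftIndex i n ≡ suc n
    shiftIndex-≮ {i} n i≮m with toℕ i <? m
    ... | yes i<m = ⊥-elim (i≮m i<m)
    ... | no  _   = refl

    data Position (i : Fin (suc m)) (n : ℕ) : Set where
      shiftedFrom : ∀ n′ → n ≡ shiftIndex i n′ → Position i n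
      lastConstant : i ≡ last → n ≡ 0 → Position i n

    position : ∀ i n → Position i n
    position i n with toℕ i <? m
    position i n       | yes i<m = shiftedFrom n (sym (shiftIndex-< n i<m))
    position i zero    | no  i≮m = lastConstant (≮m⇒last i i≮m) refl
    position i (suc n) | no  i≮m = shiftedFrom n (sym (shiftIndex-≮ n i≮m))

    coeff-shiftLast : ∀ v i n → coeff (shiftLast v i) (shiftIndex i n) ≡ coeff (v i) n
    coeff-shiftLast v i n with toℕ i <? m
    ... | yes _ = refl
    ... | no  _ = refl

    constLast-shiftLast : ∀ v → constLast (shiftLast v) ≡ 0#
    constLast-shiftLast v with toℕ last <? m
    ... | yes last<m = ⊥-elim (last≮m last<m)
    ... | no  _      = refl

    coeff-unshiftLast : ∀ w i n → coeff (unshiftLast w i) n ≡ coeff (w i) (shiftIndex i n)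
    coeff-unshiftLast w i n with toℕ i <? m
    ... | yes _ = refl
    ... | no  _ with w i
    ...   | []    = refl
    ...   | _ ∷ _ = refl

    coeff-eLast : ∀ i n → coeff (eLast i) (shiftIndex i n) ≡ 0#
    coeff-eLast i n with toℕ i <? m
    ... | yes _ = refl
    ... | no  _ = refl

    constLast-eLast : constLast eLast ≡ 1#
    constLast-eLast with toℕ last <? m
    ... | yes last<m = ⊥-elim (last≮m last<m)
    ... | no  _      = refl

    shiftLast-unshiftLast : ∀ w → constLast w ≈ 0# → shiftLast (unshiftLast w) ≋ w
    shiftLast-unshiftLast w w₀≈0 i n with position i n
    ... | shiftedFrom n′ refl =
      reflexive (trans (coeff-shiftLast (unshiftLast w) i n′) (coeff-unshiftLast w i n′))
    ... | lastConstant refl refl = ≈-trans (reflexive (constLast-shiftLast (unshiftLast w))) (≈-sym w₀≈0)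

    shiftLast-unshiftLast-supported : ∀ w i n → coeff (w i) n ≈ 0# →
                                      coeff (shiftLast (unshiftLast w) i) n ≈ 0#
    shiftLast-unshiftLast-supported w i n w≈0 with position i n
    ... | shiftedFrom n′ refl =
      ≈-trans (reflexive (trans (coeff-shiftLast (unshiftLast w) i n′) (coeff-unshiftLast w i n′))) w≈0
    ... | lastConstant refl refl = reflexive (constLast-shiftLast (unshiftLast w))

    norm-shiftLast : ∀ y v → norm (suc m) y (shiftLast v) ≡ norm (suc m) (shiftDown m y) v +ₘ ℚ.1ℚ
    norm-shiftLast y v =
      trans (maxOver-cong (suc m) term≡) (maxOver-+ₘ (suc m) (λ i → logAbs (v i) +ₘ shiftDown m y i) ℚ.1ℚ)
      where
      term≡ : ∀ i → logAbs (shiftLast v i) +ₘ y i ≡ (logAbs (v i) +ₘ shiftDown m y i) +ₘ ℚ.1ℚ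
      term≡ i with toℕ i <? m
      ... | yes _ = trans (cong (logAbs (v i) +ₘ_) (sym (p-q+q≡p (y i) ℚ.1ℚ)))
                          (sym (+ₘ-assoc (logAbs (v i)) _ ℚ.1ℚ))
      ... | no  _ = begin
        logAbs (0# ∷ v i) +ₘ y i                ≡⟨ cong (_+ₘ y i) (logAbs-0∷ (v i)) ⟩
        logAbs (v i) +ₘ ℚ.1ℚ +ₘ y i              ≡⟨ +ₘ-assoc (logAbs (v i)) ℚ.1ℚ (y i) ⟩
        logAbs (v i) +ₘ (ℚ.1ℚ ℚ.+ y i)           ≡⟨ cong (logAbs (v i) +ₘ_) (ℚ.+-comm ℚ.1ℚ (y i)) ⟩
        logAbs (v i) +ₘ (y i ℚ.+ ℚ.1ℚ)
          ≡⟨ cong (λ z → logAbs (v i) +ₘ (z ℚ.+ ℚ.1ℚ)) (ℚ.+-identityʳ (y i)) ⟨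
        logAbs (v i) +ₘ (y i ℚ.- ℚ.0ℚ ℚ.+ ℚ.1ℚ)   ≡⟨ +ₘ-assoc (logAbs (v i)) (y i ℚ.- ℚ.0ℚ) ℚ.1ℚ ⟨
        logAbs (v i) +ₘ (y i ℚ.- ℚ.0ℚ) +ₘ ℚ.1ℚ   ∎
        where open ≡-Reasoning

    norm-eLast-≤ : ¬ 1# ≈ 0# → ∀ y → norm (suc m) y eLast ≤ₘ just (y last)
    norm-eLast-≤ 1≉0 y = maxOver-lub (suc m) (λ i → logAbs (eLast i) +ₘ y i) term≤
      where
      term≤ : ∀ i → (logAbs (eLast i) +ₘ y i) ≤ₘ just (y last)
      term≤ i with toℕ i <? m
      ... | yes _   = tt
      ... | no  i≮m = ≤ₘ-trans (≤ₘ-reflexive (cong (_+ₘ y i) (logAbs-[a] 1≉0)))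
                               (ℚ.≤-reflexive (trans (ℚ.+-identityˡ (y i)) (cong y (≮m⇒last i i≮m))))

    ∑-constLast-shiftLast : ∀ {j} (a : Fin j → K) (g : Fin j → M (suc m)) →
                            ∑[ l < j ] (a l * constLast (shiftLast (g l))) ≈ 0#
    ∑-constLast-shiftLast a g =
      ∑≈0 λ l → ≈-trans (*-congˡ (reflexive (constLast-shiftLast (g l)))) (zeroʳ _)

    ∑-coeff-shiftLast : ∀ {j} (a : Fin j → K) (g : Fin j → M (suc m)) i n →
                        ∑[ l < j ] (a l * coeff (g l i) n) ≈
                        ∑[ l < j ] (a l * coeff (shiftLast (g l) i) (shiftIndex i n))
    ∑-coeff-shiftLast a g i n = sum-cong-≋ λ l → *-congˡ (reflexive (sym (coeff-shiftLast (g l) i n)))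

    Span-shiftLast : ∀ {j g v} → Span j g v → Span j (shiftLast ∘ g) (shiftLast v)
    Span-shiftLast {j} {g} {v} (span a v≈) = span a expansion
      where
      expansion : ∀ i n → coeff (shiftLast v i) n ≈ ∑[ l < j ] (a l * coeff (shiftLast (g l) i) n)
      expansion i n with position i n
      ... | shiftedFrom n′ refl =
        ≈-trans (reflexive (coeff-shiftLast v i n′)) (≈-trans (v≈ i n′) (∑-coeff-shiftLast a g i n′))
      ... | lastConstant refl refl =
        ≈-trans (reflexive (constLast-shiftLast v)) (≈-sym (∑-constLast-shiftLast a g))

    Span-unshiftLast : ∀ {j g w} → Span j g (unshiftLast w) → Span (suc j) (eLast Vector.∷ shiftLast ∘ g) w
    Span-unshiftLast {j} {g} {w} (span a w≈) = span (constLast w Vector.∷ a) expansion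
      where
      open ≈-Reasoning
      expansion : ∀ i n → coeff (w i) n ≈
                  constLast w * coeff (eLast i) n + ∑[ l < j ] (a l * coeff (shiftLast (g l) i) n)
      expansion i n with position i n
      ... | shiftedFrom n′ refl = begin
        coeff (w i) (shiftIndex i n′)                                       ≡⟨ coeff-unshiftLast w i n′ ⟨
        coeff (unshiftLast w i) n′                                          ≈⟨ w≈ i n′ ⟩
        ∑[ l < j ] (a l * coeff (g l i) n′)                                 ≈⟨ ∑-coeff-shiftLast a g i n′ ⟩
        ∑[ l < j ] (a l * coeff (shiftLast (g l) i) (shiftIndex i n′))      ≈⟨ +-identityˡ _ ⟨
        0# + ∑[ l < j ] (a l * coeff (shiftLast (g l) i) (shiftIndex i n′))
          ≈⟨ +-congʳ (≈-trans (≈-sym (zeroʳ _)) (*-congˡ (reflexive (sym (coeff-eLast i n′))))) ⟩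
        constLast w * coeff (eLast i) (shiftIndex i n′) +
          ∑[ l < j ] (a l * coeff (shiftLast (g l) i) (shiftIndex i n′))   ∎
      ... | lastConstant refl refl = begin
        constLast w                                                          ≈⟨ *-identityʳ _ ⟨
        constLast w * 1#                                                     ≈⟨ +-identityʳ _ ⟨
        constLast w * 1# + 0#
          ≈⟨ +-cong (*-congˡ (reflexive (sym constLast-eLast))) (≈-sym (∑-constLast-shiftLast a g)) ⟩
        constLast w * constLast eLast + ∑[ l < j ] (a l * constLast (shiftLast (g l)))  ∎

    Span-shiftLast⁻¹ : ∀ {j g w} h {c} → constLast h * c ≈ 1# →
                       Span (suc j) (h Vector.∷ shiftLast ∘ g) (shiftLast w) → Span j g w
    Span-shiftLast⁻¹ {j} {g} {w} h {c} hc≈1 (span a w≈) = span (a ∘ Fin.suc) expansion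
      where
      open ≈-Reasoning
      a₀ : K
      a₀ = a Fin.zero

      a₀h≈0 : a₀ * constLast h ≈ 0#
      a₀h≈0 = begin
        a₀ * constLast h                                                      ≈⟨ +-identityʳ _ ⟨
        a₀ * constLast h + 0#                           ≈⟨ +-congˡ (∑-constLast-shiftLast (a ∘ Fin.suc) g) ⟨
        a₀ * constLast h + ∑[ l < j ] (a (Fin.suc l) * constLast (shiftLast (g l)))  ≈⟨ w≈ last 0 ⟨
        constLast (shiftLast w)                                               ≡⟨ constLast-shiftLast w ⟩
        0#                                                                    ∎

      a₀≈0 : a₀ ≈ 0#
      a₀≈0 = begin
        a₀                      ≈⟨ *-identityʳ _ ⟨
        a₀ * 1#                 ≈⟨ *-congˡ hc≈1 ⟨
        a₀ * (constLast h * c)  ≈⟨ *-assoc _ _ _ ⟨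
        a₀ * constLast h * c    ≈⟨ *-congʳ a₀h≈0 ⟩
        0# * c                  ≈⟨ zeroˡ c ⟩
        0#                      ∎

      expansion : ∀ i n → coeff (w i) n ≈ ∑[ l < j ] (a (Fin.suc l) * coeff (g l i) n)
      expansion i n = begin
        coeff (w i) n                                                         ≡⟨ coeff-shiftLast w i n ⟨
        coeff (shiftLast w i) (shiftIndex i n)                                ≈⟨ w≈ i (shiftIndex i n) ⟩
        a₀ * coeff (h i) (shiftIndex i n) +
          ∑[ l < j ] (a (Fin.suc l) * coeff (shiftLast (g l) i) (shiftIndex i n))
          ≈⟨ +-cong (≈-trans (*-congʳ a₀≈0) (zeroˡ _)) (≈-sym (∑-coeff-shiftLast (a ∘ Fin.suc) g i n)) ⟩
        0# + ∑[ l < j ] (a (Fin.suc l) * coeff (g l i) n)                     ≈⟨ +-identityˡ _ ⟩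
        ∑[ l < j ] (a (Fin.suc l) * coeff (g l i) n)                          ∎

  module Shift (isField : IsField F) (m : ℕ) (x : Fin (suc m) → ℚ)
               (x∈A : InApartment (suc m) x) (x∈W : InWeylChamber (suc m) x) where

    open IsField isField
    open LastCoordinate m

    x′ : Fin (suc m) → ℚ
    x′ = shiftDown m x

    ‖_‖ ‖_‖′ : M (suc m) → Maybe ℚ
    ‖ w ‖  = norm (suc m) x w
    ‖ w ‖′ = norm (suc m) x′ w

    x-nonNeg : ∀ i → ℚ.0ℚ ℚ.≤ x i
    x-nonNeg i = subst (ℚ._≤ x i) x∈A (x∈W i last (Fin.≤fromℕ i))

    eLast-minimal : ∀ w → ¬ IsZero w → ‖ eLast ‖ ≤ₘ ‖ w ‖
    eLast-minimal w w≉0 = ≤ₘ-trans (subst (λ z → ‖ eLast ‖ ≤ₘ just z) x∈A (norm-eLast-≤ 1≉0 x))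
                                   (norm-nonNeg x w x-nonNeg w≉0)

    eLast∉Span : ∀ {j} {g : Fin j → M (suc m)} → (∀ l → constLast (g l) ≈ 0#) → ¬ Span j g eLast
    eLast∉Span g≈0 eLast∈ =
      1≉0 (≈-trans (reflexive (sym constLast-eLast)) (Span-coeff≈0 last 0 g≈0 eLast∈))

    NormsShifted : (ℕ → M (suc m)) → (ℕ → M (suc m)) → Set
    NormsShifted μ μ′ = ∀ j → ‖ μ (suc j) ‖ ≡ ‖ μ′ j ‖′ +ₘ ℚ.1ℚ

    inseparable-transfer : ∀ {μ μ′} → NormsShifted μ μ′ → ∀ k →
      (logNorm (suc m) x (μ (suc k)) ≡ logNorm (suc m) x (μ (suc (suc k)))) ⇔
      (logNorm (suc m) x′ (μ′ k) ≡ logNorm (suc m) x′ (μ′ (suc k)))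
    inseparable-transfer {μ} {μ′} shifted =
      shifted-≡⇔ (logNorm (suc m) x ∘ μ) (logNorm (suc m) x′ ∘ μ′) ℚ.1ℚ
      λ j → trans (logNorm≡norm (suc m) x (μ (suc j)))
                  (trans (shifted j) (cong (_+ₘ ℚ.1ℚ) (sym (logNorm≡norm (suc m) x′ (μ′ j)))))

    -- From a basis for x′ to a basis for x

    eLast∷shiftLast : (ℕ → M (suc m)) → ℕ → M (suc m)
    eLast∷shiftLast μ′ zero    = eLast
    eLast∷shiftLast μ′ (suc j) = shiftLast (μ′ j)

    module Lift {μ′} (B′ : SuccMinBasis (suc m) x′ μ′) where
      open SuccMinBasis B′
      open ≤ₘ-Reasoning

      μ : ℕ → M (suc m)
      μ = eLast∷shiftLast μ′

      ↾-μ : ∀ j l → (μ ↾ suc j) l ≡ (eLast Vector.∷ shiftLast ∘ (μ′ ↾ j)) l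
      ↾-μ j Fin.zero    = refl
      ↾-μ j (Fin.suc l) = refl

      independent′ : ∀ j → ¬ Span j (μ ↾ j) (μ j)
      independent′ zero    eLast∈ = eLast∉Span (λ ()) eLast∈
      independent′ (suc j) μⱼ∈ = independent j
        (Span-shiftLast⁻¹ eLast (≈-trans (*-identityʳ _) (reflexive constLast-eLast)) (Span-≗ (↾-μ j) μⱼ∈))

      minimal′ : ∀ j w → ¬ Span j (μ ↾ j) w → ‖ μ j ‖ ≤ₘ ‖ w ‖
      minimal′ zero    w w∉ = eLast-minimal w (w∉ ∘ IsZero⇒Span)
      minimal′ (suc j) w w∉ = begin
        ‖ shiftLast (μ′ j) ‖                ≡⟨ norm-shiftLast x (μ′ j) ⟩
        ‖ μ′ j ‖′ +ₘ ℚ.1ℚ                   ≤⟨ +ₘ-mono-≤ₘ ℚ.1ℚ (minimal j (unshiftLast w) unshifted∉) ⟩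
        ‖ unshiftLast w ‖′ +ₘ ℚ.1ℚ          ≡⟨ norm-shiftLast x (unshiftLast w) ⟨
        ‖ shiftLast (unshiftLast w) ‖
          ≤⟨ norm-mono x (shiftLast (unshiftLast w)) w (shiftLast-unshiftLast-supported w) ⟩
        ‖ w ‖                               ∎
        where
        unshifted∉ : ¬ Span j (μ′ ↾ j) (unshiftLast w)
        unshifted∉ = w∉ ∘ Span-≗ (sym ∘ ↾-μ j) ∘ Span-unshiftLast

      spanning′ : ∀ w → ∃ λ j → Span j (μ ↾ j) w
      spanning′ w = let j , unshifted∈ = spanning (unshiftLast w) in
        suc j , Span-≗ (sym ∘ ↾-μ j) (Span-unshiftLast unshifted∈)

      basis : SuccMinBasis (suc m) x μ
      basis = record { independent = independent′ ; minimal = minimal′ ; spanning = spanning′ }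

      norms-shifted : NormsShifted μ μ′
      norms-shifted j = norm-shiftLast x (μ′ j)

    -- From a basis for x to a basis for x′

    module Lower {μ} (B : SuccMinBasis (suc m) x μ) where
      open SuccMinBasis B

      pivot : ∃ λ p → ¬ constLast (μ p) ≈ 0# × (∀ t → t < p → constLast (μ t) ≈ 0#)
      pivot =
        let J , eLast∈ = spanning eLast
            l , μₗ≉0 , earlier≈0 = Fin.¬∀⟶∃¬-smallest J (λ l → constLast ((μ ↾ J) l) ≈ 0#)
              (λ l → constLast ((μ ↾ J) l) ≟ 0#) (λ all≈0 → eLast∉Span all≈0 eLast∈)
        in toℕ l , μₗ≉0 , λ t t<l →
             subst (λ s → constLast (μ s) ≈ 0#) (trans (Fin.toℕ-inject _) (Fin.toℕ-fromℕ< t<l))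
                   (earlier≈0 (Fin.fromℕ< t<l))

      p : ℕ
      p = proj₁ pivot

      μₚ≉0 : ¬ constLast (μ p) ≈ 0#
      μₚ≉0 = proj₁ (proj₂ pivot)

      below-pivot : ∀ t → t < p → constLast (μ t) ≈ 0#
      below-pivot = proj₂ (proj₂ pivot)

      μₚ⁻¹ : K
      μₚ⁻¹ = proj₁ (inverse (constLast (μ p)) μₚ≉0)

      μₚμₚ⁻¹≈1 : constLast (μ p) * μₚ⁻¹ ≈ 1#
      μₚμₚ⁻¹≈1 = proj₂ (inverse (constLast (μ p)) μₚ≉0)

      factor : ℕ → K
      factor t = constLast (μ t) * μₚ⁻¹

      cleared : ℕ → M (suc m)
      cleared t i = μ t i +ᴾ (- factor t) ·ᴾ μ p i

      coeff-cleared : ∀ t i n → coeff (cleared t i) n ≈ coeff (μ t i) n + - factor t * coeff (μ p i) n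
      coeff-cleared t i n = ≈-trans (coeff-+ᴾ (μ t i) _ n) (+-congˡ (coeff-·ᴾ (- factor t) (μ p i) n))

      coeff-μ : ∀ t i n → coeff (μ t i) n ≈ coeff (cleared t i) n + factor t * coeff (μ p i) n
      coeff-μ t i n = begin
        coeff (μ t i) n                                                   ≈⟨ +-identityʳ _ ⟨
        coeff (μ t i) n + 0#                                              ≈⟨ +-congˡ (zeroˡ _) ⟨
        coeff (μ t i) n + 0# * coeff (μ p i) n
          ≈⟨ +-congˡ (*-congʳ (-‿inverseˡ (factor t))) ⟨
        coeff (μ t i) n + (- factor t + factor t) * coeff (μ p i) n       ≈⟨ +-congˡ (distribʳ _ _ _) ⟩
        coeff (μ t i) n + (- factor t * coeff (μ p i) n + factor t * coeff (μ p i) n)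
          ≈⟨ +-assoc _ _ _ ⟨
        coeff (μ t i) n + - factor t * coeff (μ p i) n + factor t * coeff (μ p i) n
          ≈⟨ +-congʳ (coeff-cleared t i n) ⟨
        coeff (cleared t i) n + factor t * coeff (μ p i) n                ∎
        where open ≈-Reasoning

      constLast-cleared : ∀ t → constLast (cleared t) ≈ 0#
      constLast-cleared t = begin
        constLast (cleared t)                             ≈⟨ coeff-cleared t last 0 ⟩
        constLast (μ t) + - factor t * constLast (μ p)    ≈⟨ +-congˡ (-‿distribˡ-* _ _) ⟨
        constLast (μ t) + - (factor t * constLast (μ p))  ≈⟨ +-congˡ (-‿cong factor·μₚ) ⟩
        constLast (μ t) + - constLast (μ t)               ≈⟨ -‿inverseʳ _ ⟩
        0#                                                ∎
        where
        open ≈-Reasoning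
        factor·μₚ : factor t * constLast (μ p) ≈ constLast (μ t)
        factor·μₚ = ≈-trans (*-assoc _ _ _)
          (≈-trans (*-congˡ (≈-trans (*-comm μₚ⁻¹ _) μₚμₚ⁻¹≈1)) (*-identityʳ _))

      cleared≋μ : ∀ {t} → t < p → cleared t ≋ μ t
      cleared≋μ {t} t<p i n = ≈-trans (coeff-cleared t i n)
        (≈-trans (+-congˡ (≈-trans (*-congʳ -factor≈0) (zeroˡ _))) (+-identityʳ _))
        where
        -factor≈0 : - factor t ≈ 0#
        -factor≈0 = ≈-trans (-‿cong (≈-trans (*-congʳ (below-pivot t t<p)) (zeroˡ μₚ⁻¹))) -0#≈0#

      cleared∈ : ∀ {t S} → t < S → p < S ⊎ t < p → Span S (μ ↾ S) (cleared t)
      cleared∈ {t} t<S (inj₁ p<S) =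
        Span-+· (- factor t) (Span-↾-∋ μ t<S) (Span-↾-∋ μ p<S) (coeff-cleared t)
      cleared∈ t<S (inj₂ t<p) = Span-resp-≋ (cleared≋μ t<p) (Span-↾-∋ μ t<S)

      cleared∈⇒μ∈ : ∀ {t S} → t < p ⊎ p < S → Span S (μ ↾ S) (cleared t) → Span S (μ ↾ S) (μ t)
      cleared∈⇒μ∈ (inj₁ t<p) = Span-resp-≋ (λ i n → ≈-sym (cleared≋μ t<p i n))
      cleared∈⇒μ∈ {t} (inj₂ p<S) clearedₜ∈ = Span-+· (factor t) clearedₜ∈ (Span-↾-∋ μ p<S) (coeff-μ t)

      norm-cleared : ∀ {t} → t < p ⊎ p < t → ‖ cleared t ‖ ≡ ‖ μ t ‖
      norm-cleared {t} t≢p = ≤ₘ-antisym (cleared≤μ t≢p)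
                                        (minimal t (cleared t) (independent t ∘ cleared∈⇒μ∈ t≢p))
        where
        open ≤ₘ-Reasoning
        supported : ∀ i n → coeff (μ t i) n ≈ 0# → coeff (μ p i) n ≈ 0# → coeff (cleared t i) n ≈ 0#
        supported i n μₜ≈0 μₚ≈0 = ≈-trans (coeff-cleared t i n)
          (≈-trans (+-cong μₜ≈0 (≈-trans (*-congˡ μₚ≈0) (zeroʳ _))) (+-identityˡ 0#))
        cleared≤μ : t < p ⊎ p < t → ‖ cleared t ‖ ≤ₘ ‖ μ t ‖
        cleared≤μ (inj₁ t<p) = ≤ₘ-reflexive (norm-cong x {cleared t} {μ t} (cleared≋μ t<p))
        cleared≤μ (inj₂ p<t) = begin
          ‖ cleared t ‖        ≤⟨ norm-supported x (cleared t) (μ t) (μ p) supported ⟩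
          ‖ μ t ‖ ⊔ₘ ‖ μ p ‖   ≤⟨ ⊔ₘ-lub (≤ₘ-refl ‖ μ t ‖) (norm-mono-≤ (ℕ.<⇒≤ p<t)) ⟩
          ‖ μ t ‖              ∎

      norm-below-pivot : ∀ {t} → t ≤ p → ‖ μ t ‖ ≡ ‖ eLast ‖
      norm-below-pivot {t} t≤p = ≤ₘ-antisym
        (≤ₘ-trans (norm-mono-≤ t≤p) (minimal p eLast (eLast∉Span λ l → below-pivot (toℕ l) (Fin.toℕ<n l))))
        (eLast-minimal (μ t) (nonZero t))

      norm-skip : ∀ j → ‖ μ (skip p j) ‖ ≡ ‖ μ (suc j) ‖
      norm-skip j = by-cases (j <? p)
        where
        by-cases : Dec (j < p) → ‖ μ (skip p j) ‖ ≡ ‖ μ (suc j) ‖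
        by-cases (yes j<p) = trans (cong (‖_‖ ∘ μ) (skip-< j<p))
                                   (trans (norm-below-pivot (ℕ.<⇒≤ j<p)) (sym (norm-below-pivot j<p)))
        by-cases (no  j≮p) = cong (‖_‖ ∘ μ) (skip-≥ (ℕ.≮⇒≥ j≮p))

      μ′ : ℕ → M (suc m)
      μ′ j = unshiftLast (cleared (skip p j))

      shiftLast-μ′ : ∀ j → shiftLast (μ′ j) ≋ cleared (skip p j)
      shiftLast-μ′ j = shiftLast-unshiftLast (cleared (skip p j)) (constLast-cleared (skip p j))

      norms-shifted : NormsShifted μ μ′
      norms-shifted j = begin-equality
        ‖ μ (suc j) ‖              ≡⟨ norm-skip j ⟨
        ‖ μ (skip p j) ‖           ≡⟨ norm-cleared (skip-≢ p j) ⟨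
        ‖ cleared (skip p j) ‖     ≡⟨ norm-cong x {shiftLast (μ′ j)} {cleared (skip p j)} (shiftLast-μ′ j) ⟨
        ‖ shiftLast (μ′ j) ‖       ≡⟨ norm-shiftLast x (μ′ j) ⟩
        ‖ μ′ j ‖′ +ₘ ℚ.1ℚ          ∎
        where open ≤ₘ-Reasoning

      μ∈pivot∷shiftLast : ∀ {j t} → t < skip p j → Span (suc j) (μ p Vector.∷ shiftLast ∘ (μ′ ↾ j)) (μ t)
      μ∈pivot∷shiftLast {j} {t} t<s = by-cases (t ℕ.≟ p)
        where
        G : Fin (suc j) → M (suc m)
        G = μ p Vector.∷ shiftLast ∘ (μ′ ↾ j)
        skipped∈ : ∀ j′ → skip p j′ < skip p j → Span (suc j) G (μ (skip p j′))
        skipped∈ j′ lt = Span-+· (factor (skip p j′))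
                                 (Span-∷ (μ p) (Span-↾-∋ (shiftLast ∘ μ′) (skip-cancel-< p lt)))
                                 (Span-∋ G Fin.zero) λ i n →
          ≈-trans (coeff-μ (skip p j′) i n) (+-congʳ (≈-sym (shiftLast-μ′ j′ i n)))
        by-cases : Dec (t ≡ p) → Span (suc j) G (μ t)
        by-cases (yes t≡p) = subst (Span (suc j) G ∘ μ) (sym t≡p) (Span-∋ G Fin.zero)
        by-cases (no  t≢p) = let j′ , skip≡t = skip-surjective t≢p in
          subst (Span (suc j) G ∘ μ) skip≡t (skipped∈ j′ (subst (_< skip p j) (sym skip≡t) t<s))

      lower-Span : ∀ j {w} → Span (skip p j) (μ ↾ skip p j) (shiftLast w) → Span j (μ′ ↾ j) w
      lower-Span j w∈ = Span-shiftLast⁻¹ (μ p) μₚμₚ⁻¹≈1 (Span-trans (μ∈pivot∷shiftLast ∘ Fin.toℕ<n) w∈)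

      independent′ : ∀ j → ¬ Span j (μ′ ↾ j) (μ′ j)
      independent′ j μ′ⱼ∈ = independent s (cleared∈⇒μ∈ (skip-≢ p j) clearedₛ∈)
        where
        s : ℕ
        s = skip p j
        generator∈ : ∀ l → Span s (μ ↾ s) (shiftLast (μ′ (toℕ l)))
        generator∈ l = Span-resp-≋ (shiftLast-μ′ (toℕ l)) (cleared∈ (skip-mono-< p (Fin.toℕ<n l)) side)
          where
          side : p < s ⊎ skip p (toℕ l) < p
          side = [ (λ s<p → inj₂ (ℕ.<-trans (skip-mono-< p (Fin.toℕ<n l)) s<p)) , inj₁ ]′ (skip-≢ p j)
        clearedₛ∈ : Span s (μ ↾ s) (cleared s)
        clearedₛ∈ = Span-trans generator∈
          (Span-resp-≋ (λ i n → ≈-sym (shiftLast-μ′ j i n)) (Span-shiftLast μ′ⱼ∈))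

      minimal′ : ∀ j w → ¬ Span j (μ′ ↾ j) w → ‖ μ′ j ‖′ ≤ₘ ‖ w ‖′
      minimal′ j w w∉ = +ₘ-cancelʳ-≤ₘ ℚ.1ℚ (begin
        ‖ μ′ j ‖′ +ₘ ℚ.1ℚ    ≡⟨ norms-shifted j ⟨
        ‖ μ (suc j) ‖        ≡⟨ norm-skip j ⟨
        ‖ μ (skip p j) ‖     ≤⟨ minimal (skip p j) (shiftLast w) (w∉ ∘ lower-Span j) ⟩
        ‖ shiftLast w ‖      ≡⟨ norm-shiftLast x w ⟩
        ‖ w ‖′ +ₘ ℚ.1ℚ       ∎)
        where open ≤ₘ-Reasoning

      spanning′ : ∀ w → ∃ λ j → Span j (μ′ ↾ j) w
      spanning′ w = let J , shifted∈ = spanning (shiftLast w) in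
        J , lower-Span J (prefix-mono (n≤skip p J) shifted∈)

      basis : SuccMinBasis (suc m) x′ μ′
      basis = record { independent = independent′ ; minimal = minimal′ ; spanning = spanning′ }

    lift-inseparable : ∀ k → Inseparable (suc m) x′ (suc k) → Inseparable (suc m) x (suc (suc k))
    lift-inseparable k (μ′ , B′ , μ′ₖ≡μ′ₖ₊₁) =
      μ , toIsSuccMinBasis basis ,
      Equivalence.from (inseparable-transfer {μ} {μ′} norms-shifted k) μ′ₖ≡μ′ₖ₊₁
      where open Lift {μ′} (fromIsSuccMinBasis B′)

    lower-inseparable : ∀ k → Inseparable (suc m) x (suc (suc k)) → Inseparable (suc m) x′ (suc k)
    lower-inseparable k (μ , B , μₖ₊₁≡μₖ₊₂) =
      μ′ , toIsSuccMinBasis basis ,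
      Equivalence.to (inseparable-transfer {μ} {μ′} norms-shifted k) μₖ₊₁≡μₖ₊₂
      where open Lower {μ} (fromIsSuccMinBasis B)

proposition2p8 :
    {c ℓ : Level} (F : CommutativeRing c ℓ) → IsField F →
    (_≟_ : Decidable (CommutativeRing._≈_ F)) →
    (q : ℕ) → Inverse (CommutativeRing.setoid F) (setoid (Fin q)) →
    (m : ℕ) → 1 ≤ m →
    (x : Fin (suc m) → ℚ) → InApartment (suc m) x → InWeylChamber (suc m) x →
    (k : ℕ) → 1 ≤ k →
    (PolyNorm.Inseparable F _≟_ (suc m) x (suc k)
      ⇔ PolyNorm.Inseparable F _≟_ (suc m) (shiftDown m x) k)
proposition2p8 F isField _≟_ _ _ m _ x x∈A x∈W (suc k) _ =
  mk⇔ (lower-inseparable k) (lift-inseparable k)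
  where open Shift F _≟_ isField m x x∈A x∈W
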